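{- $\textsc{Closure}_{M_2}\in\mathsf{P}$, where $M_2$ is the clone generated by $\wedge$ and $\vee$.
   Context: Boolean operations act on vectors of $\{0,1\}^n$ coordinate-wise; $Cl_{M_2}(\mathcal{S})$ is the smallest set of vectors containing $\mathcal{S}$ and closed under coordinate-wise $\wedge$ and $\vee$. $\textsc{Closure}_{M_2}$: given a finite set $\mathcal{S}\subseteq\{0,1\}^n$ and $v\in\{0,1\}^n$, decide whether $v\in Cl_{M_2}(\mathcal{S})$. -}

module Defs where

open import Data.Nat using (ℕ; zero; suc; _+_; _*_; _^_)
open import Data.Bool using (Bool; true; false; _∧_; _∨_)
open import Data.Fin using (Fin; zero; suc)
open import Data.Vec using (Vec; []; _∷_; zipWith; toList)
open import Data.List using (List; []; _∷_; _++_; concatMap; map; length)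
open import Data.List.Membership.Propositional using (_∈_)
open import Data.Product using (Σ; _×_; _,_)
open import Data.Maybe using (Maybe; just; nothing)
open import Relation.Binary.PropositionalEquality using (_≡_)

data Cl {n : ℕ} (S : List (Vec Bool n)) : Vec Bool n → Set where
  base : ∀ {x} → x ∈ S → Cl S x
  meet : ∀ {x y} → Cl S x → Cl S y → Cl S (zipWith _∧_ x y)
  join : ∀ {x y} → Cl S x → Cl S y → Cl S (zipWith _∨_ x y)

data InSym : Set where
  b0 b1 sep : InSym

encBit : Bool → InSym
encBit false = b0
encBit true  = b1

encVec : ∀ {n} → Vec Bool n → List InSym
encVec v = map encBit (toList v) ++ (sep ∷ [])

-- An instance (S, v) with S ⊆ {0,1}ⁿ finite (given as a list) and
-- v ∈ {0,1}ⁿ is encoded as  v # s₁ # s₂ # … sₖ #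
encode : (n : ℕ) → List (Vec Bool n) → Vec Bool n → List InSym
encode n S v = encVec v ++ concatMap encVec S

ClosureM₂ : List InSym → Set
ClosureM₂ w = Σ ℕ λ n → Σ (List (Vec Bool n)) λ S → Σ (Vec Bool n) λ v →
  (w ≡ encode n S v) × Cl S v

data Move : Set where
  L R N : Move

data Action (q k : ℕ) : Set where
  halt : Bool → Action q k                  -- halt, accepting iff true
  go   : Fin q → Fin k → Move → Action q k

-- tape symbols: 0 = blank, 1 = b0, 2 = b1, 3 = sep, others = work symbols
record TM : Set where
  field
    Q     : ℕ
    Γ     : ℕ
    start : Fin Q
    δ     : Fin Q → Fin (4 + Γ) → Action Q (4 + Γ)

open TM public

Sym : TM → Set
Sym M = Fin (4 + Γ M)

inSym : (M : TM) → InSym → Sym M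
inSym M b0  = suc zero
inSym M b1  = suc (suc zero)
inSym M sep = suc (suc (suc zero))

-- configuration: state, cells left of head (nearest first), cells from
-- head rightwards (empty list = blanks)
record Config (M : TM) : Set where
  constructor ⟨_,_,_⟩
  field
    state : Fin (Q M)
    left  : List (Sym M)
    right : List (Sym M)

initial : (M : TM) → List InSym → Config M
initial M w = ⟨ start M , [] , map (inSym M) w ⟩

headSym : ∀ {M} → List (Sym M) → Sym M
headSym []      = zero
headSym (s ∷ _) = s

tailSym : ∀ {M} → List (Sym M) → List (Sym M)
tailSym []       = []
tailSym (_ ∷ xs) = xs

move : ∀ {M} → Fin (Q M) → Sym M → Move → List (Sym M) → List (Sym M) → Config M
move q s L []       r = ⟨ q , [] , s ∷ r ⟩          -- at left end: stay
move q s L (l ∷ ls) r = ⟨ q , ls , l ∷ s ∷ r ⟩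
move q s R ls       r = ⟨ q , s ∷ ls , r ⟩
move q s N ls       r = ⟨ q , ls , s ∷ r ⟩

run : (M : TM) → ℕ → Config M → Maybe Bool
run M t ⟨ q , ls , rs ⟩ with δ M q (headSym {M} rs)
... | halt b = just b
... | go q′ s m with t
...   | zero  = nothing
...   | suc t′ = run M t′ (move {M} q′ s m ls (tailSym {M} rs))

InP : (List InSym → Set) → Set
InP Lang = Σ TM λ M → Σ ℕ λ c → Σ ℕ λ d → ∀ (w : List InSym) →
  Σ Bool λ b → (run M (c * suc (length w) ^ d) (initial M w) ≡ just b)
             × (b ≡ true → Lang w) × (Lang w → b ≡ true)

-- A vector v lies in the closure of a nonempty set S under coordinatewise ∧ and ∨ iff, for all positions i and j,
-- some s ∈ S has s_i = 1 if v_i = 1, some s ∈ S has s_j = 0 if v_j = 0, and some s ∈ S has s_i = 1 and s_j = 0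
-- if v_i = 1 and v_j = 0. These conditions are necessary because each of the three properties of a vector can
-- only hold of x ∧ y or x ∨ y if it holds of x or of y; they are sufficient because then
-- v = ⋁_{v_i = 1} ⋀_{v_j = 0} s^{ij}.
--
-- A single-tape machine decides the criterion. Every block of the input carries two position counters, kept as
-- marks on its cells, and each pass sweeps the tape once and rewinds. After a parsing pass, the machine moves the
-- i-counter and, for each of its positions, the j-counter through the first block, and compares the bits under
-- both counters in all blocks; moving a counter also checks that all blocks have the same length. That is O(n²)
-- passes of O(n) steps on an input of length n.

module Submission where

open import Defs
open import Data.Nat using (ℕ; zero; suc; pred; _+_; _*_; _^_; _∸_; _≤_; _<_; z≤n; s≤s)
open import Data.Nat.Properties
  using (+-assoc; +-comm; +-suc; +-identityʳ; +-monoʳ-≤; +-monoˡ-≤; +-mono-≤; *-mono-≤; ≤-antisym; ≤-trans; ≤-refl;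
         ≤-reflexive; <-irrefl; n≤1+n; m≤m+n; m≤n⇒m<n∨m≡n; m+[n∸m]≡n; module ≤-Reasoning)
open import Data.Nat.Solver using (module +-*-Solver)
open import Data.Bool using (Bool; true; false; _∧_; _∨_; not; _xor_; if_then_else_)
open import Data.Bool.Properties using (∧-conicalˡ; ∧-conicalʳ; ∨-conicalˡ; ∨-conicalʳ; ∧-zeroʳ; ∨-zeroʳ; xor-same)
open import Data.Fin using (Fin; zero; suc; toℕ; fromℕ<; combine; remQuot; splitAt; _↑ˡ_; _↑ʳ_)
open import Data.Fin.Properties using (remQuot-combine; splitAt-↑ˡ; splitAt-↑ʳ; toℕ-fromℕ<; toℕ<n)
open import Data.Vec using (Vec; []; _∷_; zipWith; lookup; tabulate; toList)
open import Data.Vec.Properties using (lookup-zipWith; tabulate∘lookup; tabulate-cong; length-toList)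
open import Data.List using (List; []; _∷_; _++_; _ʳ++_; map; length; null; concat; concatMap; allFin)
open import Data.List.Properties using (length-map; map-∘; ++-assoc; ++-identityʳ)
open import Data.List.Relation.Unary.All using (All; []; _∷_)
import Data.List.Relation.Unary.All as All
open import Data.List.Relation.Unary.All.Properties using () renaming (map⁺ to All-map⁺)
open import Data.List.Relation.Unary.Any using (Any; here; there)
import Data.List.Relation.Unary.Any as Any
open import Data.List.Relation.Unary.Any.Properties using () renaming (map⁺ to Any-map⁺; map⁻ to Any-map⁻)
open import Data.List.Membership.Propositional using (_∈_; find; lose)
open import Data.List.Membership.Propositional.Properties using (∈-allFin)
open import Data.Maybe using (Maybe; just; nothing; fromMaybe)
import Data.Maybe as Maybe
open import Data.Product using (Σ; ∃; _×_; _,_; proj₁; proj₂; map₂)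
open import Data.Sum using (_⊎_; inj₁; inj₂; [_,_])
open import Data.Unit using (⊤; tt)
open import Data.Empty using (⊥; ⊥-elim)
open import Relation.Nullary using (¬_)
open import Relation.Binary.PropositionalEquality hiding ([_])
open import Function using (_∘_)
open +-*-Solver using (solve; _:+_; _:*_; _:=_; con)

∧-≡false : ∀ a b → a ∧ b ≡ false → a ≡ false ⊎ b ≡ false
∧-≡false false b _ = inj₁ refl
∧-≡false true  b e = inj₂ e

∨-≡true : ∀ a b → a ∨ b ≡ true → a ≡ true ⊎ b ≡ true
∨-≡true true  b _ = inj₁ refl
∨-≡true false b e = inj₂ e

true≢false : true ≢ false
true≢false ()

≡true-antisym : ∀ {a b} → (a ≡ true → b ≡ true) → (b ≡ true → a ≡ true) → a ≡ b
≡true-antisym {true}  a⇒b _   = sym (a⇒b refl)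
≡true-antisym {false} {true}  _ b⇒a = b⇒a refl
≡true-antisym {false} {false} _ _   = refl

xor-≡false : ∀ a b → a xor b ≡ false → a ≡ b
xor-≡false true  true  _ = refl
xor-≡false false false _ = refl

not-∨-elim : ∀ a x → not a ∨ x ≡ true → a ≡ true → x ≡ true
not-∨-elim true x e refl = e

not-∨-intro : ∀ a x → (a ≡ true → x ≡ true) → not a ∨ x ≡ true
not-∨-intro true  x h = h refl
not-∨-intro false x h = refl

not-≡true : ∀ {b} → not b ≡ true → b ≡ false
not-≡true {false} _ = refl

-- The closure of a set of Boolean vectors

module _ {n : ℕ} where

  lookup-∧ : ∀ (x y : Vec Bool n) i → lookup (zipWith _∧_ x y) i ≡ lookup x i ∧ lookup y i
  lookup-∧ x y i = lookup-zipWith _∧_ i x y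

  lookup-∨ : ∀ (x y : Vec Bool n) i → lookup (zipWith _∨_ x y) i ≡ lookup x i ∨ lookup y i
  lookup-∨ x y i = lookup-zipWith _∨_ i x y

  _⊑_ : Vec Bool n → Vec Bool n → Set
  x ⊑ y = ∀ k → lookup x k ≡ true → lookup y k ≡ true

  ⊑-antisym : ∀ {x y} → x ⊑ y → y ⊑ x → x ≡ y
  ⊑-antisym {x} {y} x⊑y y⊑x = begin
    x                    ≡⟨ tabulate∘lookup x ⟨
    tabulate (lookup x)  ≡⟨ tabulate-cong (λ k → ≡true-antisym (x⊑y k) (y⊑x k)) ⟩
    tabulate (lookup y)  ≡⟨ tabulate∘lookup y ⟩
    y                    ∎
    where open ≡-Reasoning

  Prime : (Vec Bool n → Set) → Set
  Prime P = ∀ x y → (P (zipWith _∧_ x y) → P x ⊎ P y) × (P (zipWith _∨_ x y) → P x ⊎ P y)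

  ⊤-prime : Prime (λ _ → ⊤)
  ⊤-prime _ _ = (λ _ → inj₁ tt) , (λ _ → inj₁ tt)

  true-at-prime : ∀ i → Prime (λ x → lookup x i ≡ true)
  true-at-prime i x y =
    (λ e → inj₁ (∧-conicalˡ _ _ (trans (sym (lookup-∧ x y i)) e))) ,
    (λ e → ∨-≡true _ _ (trans (sym (lookup-∨ x y i)) e))

  false-at-prime : ∀ j → Prime (λ x → lookup x j ≡ false)
  false-at-prime j x y =
    (λ e → ∧-≡false _ _ (trans (sym (lookup-∧ x y j)) e)) ,
    (λ e → inj₁ (∨-conicalˡ _ _ (trans (sym (lookup-∨ x y j)) e)))

  true-false-at-prime : ∀ i j → Prime (λ x → lookup x i ≡ true × lookup x j ≡ false)
  true-false-at-prime i j x y = meet-case , join-case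
    where
    P : Vec Bool n → Set
    P z = lookup z i ≡ true × lookup z j ≡ false
    meet-case : P (zipWith _∧_ x y) → P x ⊎ P y
    meet-case (xyi , xyj) with ∧-≡false _ _ (trans (sym (lookup-∧ x y j)) xyj)
    ... | inj₁ xj = inj₁ (∧-conicalˡ _ _ (trans (sym (lookup-∧ x y i)) xyi) , xj)
    ... | inj₂ yj = inj₂ (∧-conicalʳ _ _ (trans (sym (lookup-∧ x y i)) xyi) , yj)
    join-case : P (zipWith _∨_ x y) → P x ⊎ P y
    join-case (xyi , xyj) with ∨-≡true _ _ (trans (sym (lookup-∨ x y i)) xyi)
    ... | inj₁ xi = inj₁ (xi , ∨-conicalˡ _ _ (trans (sym (lookup-∨ x y j)) xyj))
    ... | inj₂ yi = inj₂ (yi , ∨-conicalʳ _ _ (trans (sym (lookup-∨ x y j)) xyj))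

  SeparatedAt : List (Vec Bool n) → Vec Bool n → Fin n → Fin n → Set
  SeparatedAt S v i j =
      (lookup v i ≡ true → lookup v j ≡ false → Any (λ s → lookup s i ≡ true × lookup s j ≡ false) S)
    × (lookup v i ≡ true → Any (λ s → lookup s i ≡ true) S)
    × (lookup v j ≡ false → Any (λ s → lookup s j ≡ false) S)

  Separated : List (Vec Bool n) → Vec Bool n → Set
  Separated S v = Any (λ _ → ⊤) S × (∀ i j → SeparatedAt S v i j)

  module _ {S : List (Vec Bool n)} where

    closure⇒any : ∀ {P : Vec Bool n → Set} → Prime P → ∀ {x} → Cl S x → P x → Any P S
    closure⇒any prime (base x∈S) px = lose x∈S px
    closure⇒any prime (meet {x} {y} cx cy) pxy with proj₁ (prime x y) pxy
    ... | inj₁ px = closure⇒any prime cx px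
    ... | inj₂ py = closure⇒any prime cy py
    closure⇒any prime (join {x} {y} cx cy) pxy with proj₂ (prime x y) pxy
    ... | inj₁ px = closure⇒any prime cx px
    ... | inj₂ py = closure⇒any prime cy py

    any⇒closure : ∀ {P : Vec Bool n → Set} → Any P S → ∃ λ x → Cl S x × P x
    any⇒closure a with find a
    ... | x , x∈S , px = x , base x∈S , px

    closure⇒separated : ∀ {v} → Cl S v → Separated S v
    closure⇒separated c =
      closure⇒any ⊤-prime c tt ,
      λ i j → (λ vi vj → closure⇒any (true-false-at-prime i j) c (vi , vj)) ,
              closure⇒any (true-at-prime i) c ,
              closure⇒any (false-at-prime j) c

  BelowOn : List (Fin n) → Vec Bool n → Vec Bool n → Set
  BelowOn J x y = ∀ k → k ∈ J → lookup x k ≡ true → lookup y k ≡ true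

  BelowOn-allFin : ∀ x y → BelowOn (allFin n) x y → x ⊑ y
  BelowOn-allFin _ _ below k = below k (∈-allFin k)

  module _ {S : List (Vec Bool n)} {v : Vec Bool n} where

    meet-below : ∀ {P : Vec Bool n → Set} → (∀ x y → P x → P y → P (zipWith _∧_ x y)) →
      ∃ (λ x → Cl S x × P x) →
      (∀ j → lookup v j ≡ false → ∃ λ w → Cl S w × P w × lookup w j ≡ false) →
      ∀ J → ∃ λ x → Cl S x × P x × BelowOn J x v
    meet-below _ (x , cx , px) _ [] = x , cx , px , λ _ ()
    meet-below P-∧ start cut (j ∷ J) with meet-below P-∧ start cut J | lookup v j in vj
    ... | x , cx , px , below | true = x , cx , px , λ { _ (here refl) _ → vj ; k (there k∈J) → below k k∈J }
    ... | x , cx , px , below | false with cut j vj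
    ...   | w , cw , pw , wj = zipWith _∧_ x w , meet cx cw , P-∧ x w px pw , λ
      { _ (here refl) xwj → ⊥-elim (true≢false (trans (sym (∧-conicalʳ _ _ (trans (sym (lookup-∧ x w j)) xwj))) wj))
      ; k (there k∈J) xwk → below k k∈J (∧-conicalˡ _ _ (trans (sym (lookup-∧ x w k)) xwk)) }

    join-above : ∃ (λ y → Cl S y × y ⊑ v) →
      (∀ i → lookup v i ≡ true → ∃ λ x → Cl S x × lookup x i ≡ true × x ⊑ v) →
      ∀ I → ∃ λ y → Cl S y × y ⊑ v × BelowOn I v y
    join-above (y , cy , y⊑v) _ [] = y , cy , y⊑v , λ _ ()
    join-above bottom raise (i ∷ I) with join-above bottom raise I | lookup v i in vi
    ... | y , cy , y⊑v , above | false = y , cy , y⊑v , λ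
      { _ (here refl) vi′ → ⊥-elim (true≢false (trans (sym vi′) vi)) ; k (there k∈I) → above k k∈I }
    ... | y , cy , y⊑v , above | true with raise i vi
    ...   | x , cx , xi , x⊑v = zipWith _∨_ y x , join cy cx , yx⊑v , λ
      { _ (here refl) _ → trans (lookup-∨ y x i) (trans (cong (lookup y i ∨_) xi) (∨-zeroʳ _))
      ; k (there k∈I) vk → trans (lookup-∨ y x k) (cong (_∨ lookup x k) (above k k∈I vk)) }
      where
      yx⊑v : zipWith _∨_ y x ⊑ v
      yx⊑v k e with ∨-≡true _ _ (trans (sym (lookup-∨ y x k)) e)
      ... | inj₁ yk = y⊑v k yk
      ... | inj₂ xk = x⊑v k xk

    separated⇒closure : Separated S v → Cl S v
    separated⇒closure (nonempty , separation) =
      let (y , cy , y⊑v , v⊑y) = join-above bottom raise (allFin n)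
      in subst (Cl S) (⊑-antisym y⊑v (BelowOn-allFin v y v⊑y)) cy
      where

      bottom : ∃ λ y → Cl S y × y ⊑ v
      bottom =
        let (s , cs , _) = any⇒closure nonempty
            (y , cy , _ , below) = meet-below {P = λ _ → ⊤} (λ _ _ _ _ → tt) (s , cs , tt) cut (allFin n)
        in y , cy , BelowOn-allFin y v below
        where
        cut : ∀ j → lookup v j ≡ false → ∃ λ w → Cl S w × ⊤ × lookup w j ≡ false
        cut j vj = let (w , cw , wj) = any⇒closure (proj₂ (proj₂ (separation j j)) vj) in w , cw , tt , wj

      raise : ∀ i → lookup v i ≡ true → ∃ λ x → Cl S x × lookup x i ≡ true × x ⊑ v
      raise i vi =
        let (x , cx , xi , below) = meet-below true-∧ (any⇒closure (proj₁ (proj₂ (separation i i)) vi))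
                                      (λ j vj → any⇒closure (proj₁ (separation i j) vi vj)) (allFin n)
        in x , cx , xi , BelowOn-allFin x v below
        where
        true-∧ : ∀ x y → lookup x i ≡ true → lookup y i ≡ true → lookup (zipWith _∧_ x y) i ≡ true
        true-∧ x y xi yi = trans (lookup-∧ x y i) (cong₂ _∧_ xi yi)

record Finite (A : Set) : Set where
  field
    size         : ℕ
    index        : A → Fin size
    decode       : Fin size → A
    decode-index : ∀ a → decode (index a) ≡ a
open Finite

enumerated : ∀ {A : Set} {k} (xs : Vec A k) (index : A → Fin k) → (∀ a → lookup xs (index a) ≡ a) → Finite A
enumerated xs i p = record { size = _ ; index = i ; decode = lookup xs ; decode-index = p }

Bool-finite : Finite Bool
Bool-finite = enumerated (false ∷ true ∷ []) (λ { false → zero ; true → suc zero }) λ { false → refl ; true → refl }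

_×-finite_ : ∀ {A B} → Finite A → Finite B → Finite (A × B)
FA ×-finite FB = record
  { size         = size FA * size FB
  ; index        = λ (a , b) → combine (index FA a) (index FB b)
  ; decode       = decode² ∘ remQuot (size FB)
  ; decode-index = λ (a , b) → trans (cong decode² (remQuot-combine (index FA a) (index FB b)))
                                      (cong₂ _,_ (decode-index FA a) (decode-index FB b))
  }
  where
  decode² : Fin (size FA) × Fin (size FB) → _
  decode² (i , j) = decode FA i , decode FB j

_⊎-finite_ : ∀ {A B} → Finite A → Finite B → Finite (A ⊎ B)
FA ⊎-finite FB = record
  { size         = size FA + size FB
  ; index        = [ (λ a → index FA a ↑ˡ size FB) , (λ b → size FA ↑ʳ index FB b) ]
  ; decode       = [ (λ i → inj₁ (decode FA i)) , (λ j → inj₂ (decode FB j)) ] ∘ splitAt (size FA)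
  ; decode-index = λ
    { (inj₁ a) → trans (cong [ _ , _ ] (splitAt-↑ˡ (size FA) (index FA a) (size FB))) (cong inj₁ (decode-index FA a))
    ; (inj₂ b) → trans (cong [ _ , _ ] (splitAt-↑ʳ (size FA) (size FB) (index FB b))) (cong inj₂ (decode-index FB b)) }
  }

retract : ∀ {A B : Set} (f : A → B) (g : B → A) → (∀ a → g (f a) ≡ a) → Finite B → Finite A
retract f g gf FB = record
  { size         = size FB
  ; index        = index FB ∘ f
  ; decode       = g ∘ decode FB
  ; decode-index = λ a → trans (cong g (decode-index FB (f a))) (gf a)
  }

-- The machine

data Letter : Set where
  bit       : Bool → Letter
  separator : Letter

-- Along a block, the marks passed … passed current fresh … fresh store a counter k, the number of cells
-- that are not fresh; a comparison pass reads the bit under current, at position k - 1.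
data Mark : Set where
  fresh current passed : Mark

record Cell : Set where
  constructor cell
  field
    letter : Letter
    iMark  : Mark
    jMark  : Mark

record Square : Set where
  constructor square
  field
    content  : Cell
    leftmost : Bool   -- set on the first square only; a rewind stops there
open Square public

data Symbol : Set where
  blank   : Symbol
  written : Square → Symbol

data Count : Set where
  none one several : Count

-- The arguments of the phases of a pass are:
--   parse atStart separatorsSeen afterSeparator;
--   advanceI/advanceJ inFirstBlock counterMoved firstBlockLongEnough someBlockDisagrees;
--   compare inFirstBlock bitI bitJ bitIOfFirst bitJOfFirst someSeparates someTrueAtI someFalseAtJ.
data Phase : Set where
  parse    : Bool → Count → Bool → Phase
  advanceI : Bool → Bool → Bool → Bool → Phase
  advanceJ : Bool → Bool → Bool → Bool → Phase
  compare  : Bool → Maybe Bool → Maybe Bool → Maybe Bool → Maybe Bool → Bool → Bool → Bool → Phase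

data Mode : Set where
  sweep rewind : Phase → Mode

data PassEnd : Set where
  finish   : Bool → PassEnd
  continue : Phase → PassEnd

data Step : Set where
  halts : Bool → Step
  moves : Mode → Symbol → Move → Step

next : Count → Count
next none    = one
next one     = several
next several = several

advanceMark : Bool → Mark → Bool × Mark
advanceMark carry passed  = carry , passed
advanceMark carry current = carry , passed
advanceMark false fresh   = true , current
advanceMark true  fresh   = true , fresh

readMarked : Maybe Bool → Mark → Bool → Maybe Bool
readMarked r current b = just b
readMarked r fresh   b = r
readMarked r passed  b = r

isTrue isFalse : Maybe Bool → Bool
isTrue  = fromMaybe false
isFalse = fromMaybe false ∘ Maybe.map not

startParse startI startJ startCompare : Phase
startParse   = parse true none true
startI       = advanceI true false false false
startJ       = advanceJ true false false false
startCompare = compare true nothing nothing nothing nothing false false false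

stepCell : Phase → Cell → Phase × Cell
stepCell (parse _ c _) (cell (bit b) x y) = parse false c false , cell (bit b) x y
stepCell (parse _ c _) (cell separator x y) = parse false (next c) true , cell separator x y
stepCell (advanceI first carry f bad) (cell (bit b) x y) =
  advanceI first (proj₁ (advanceMark carry x)) f bad , cell (bit b) (proj₂ (advanceMark carry x)) fresh
stepCell (advanceI true carry f bad) (cell separator x y) = advanceI false false carry bad , cell separator x y
stepCell (advanceI false carry f bad) (cell separator x y) =
  advanceI false false f (bad ∨ (carry xor f)) , cell separator x y
stepCell (advanceJ first carry f bad) (cell (bit b) x y) =
  advanceJ first (proj₁ (advanceMark carry y)) f bad , cell (bit b) x (proj₂ (advanceMark carry y))
stepCell (advanceJ true carry f bad) (cell separator x y) = advanceJ false false carry bad , cell separator x y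
stepCell (advanceJ false carry f bad) (cell separator x y) =
  advanceJ false false f (bad ∨ (carry xor f)) , cell separator x y
stepCell (compare first a b vi vj sij si sj) (cell (bit z) x y) =
  compare first (readMarked a x z) (readMarked b y z) vi vj sij si sj , cell (bit z) x y
stepCell (compare true a b vi vj sij si sj) (cell separator x y) =
  compare false nothing nothing a b sij si sj , cell separator x y
stepCell (compare false a b vi vj sij si sj) (cell separator x y) =
  compare false nothing nothing vi vj (sij ∨ (isTrue a ∧ isFalse b)) (si ∨ isTrue a) (sj ∨ isFalse b) ,
  cell separator x y

pairOK : Maybe Bool → Maybe Bool → Bool → Bool → Bool → Bool
pairOK vi vj sij si sj = (not (isTrue vi ∧ isFalse vj) ∨ sij) ∧ ((not (isTrue vi) ∨ si) ∧ (not (isFalse vj) ∨ sj))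

endOfPass : Phase → PassEnd
endOfPass (parse _ several true)          = continue startI
endOfPass (parse _ _ _)                   = finish false
endOfPass (advanceI _ _ _ true)           = finish false
endOfPass (advanceI _ _ false false)      = finish true
endOfPass (advanceI _ _ true false)       = continue startJ
endOfPass (advanceJ _ _ _ true)           = finish false
endOfPass (advanceJ _ _ false false)      = continue startI
endOfPass (advanceJ _ _ true false)       = continue startCompare
endOfPass (compare _ _ _ vi vj sij si sj) = if pairOK vi vj sij si sj then continue startJ else finish false

leftmostAfter : Phase → Bool → Bool
leftmostAfter (parse atStart _ _) _ = atStart
leftmostAfter (advanceI _ _ _ _) l = l
leftmostAfter (advanceJ _ _ _ _) l = l
leftmostAfter (compare _ _ _ _ _ _ _ _) l = l

stepSquare : Phase → Square → Phase × Square
stepSquare s (square c l) = proj₁ (stepCell s c) , square (proj₂ (stepCell s c)) (leftmostAfter s l)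

afterPass : PassEnd → Step
afterPass (finish b)   = halts b
afterPass (continue s) = moves (rewind s) blank N

transition : Mode → Symbol → Step
transition (sweep s)  (written x) = moves (sweep (proj₁ (stepSquare s x))) (written (proj₂ (stepSquare s x))) R
transition (sweep s)  blank = afterPass (endOfPass s)
transition (rewind s) (written (square c true))  = transition (sweep s) (written (square c true))
transition (rewind s) (written (square c false)) = moves (rewind s) (written (square c false)) L
transition (rewind s) blank = moves (rewind s) blank L

Mark-finite : Finite Mark
Mark-finite = enumerated (fresh ∷ current ∷ passed ∷ [])
  (λ { fresh → zero ; current → suc zero ; passed → suc (suc zero) })
  (λ { fresh → refl ; current → refl ; passed → refl })

Letter-finite : Finite Letter
Letter-finite = enumerated (bit false ∷ bit true ∷ separator ∷ [])
  (λ { (bit false) → zero ; (bit true) → suc zero ; separator → suc (suc zero) })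
  (λ { (bit false) → refl ; (bit true) → refl ; separator → refl })

Count-finite : Finite Count
Count-finite = enumerated (none ∷ one ∷ several ∷ [])
  (λ { none → zero ; one → suc zero ; several → suc (suc zero) })
  (λ { none → refl ; one → refl ; several → refl })

MaybeBool-finite : Finite (Maybe Bool)
MaybeBool-finite = enumerated (nothing ∷ just false ∷ just true ∷ [])
  (λ { nothing → zero ; (just false) → suc zero ; (just true) → suc (suc zero) })
  (λ { nothing → refl ; (just false) → refl ; (just true) → refl })

-- The letter varies fastest, so the unflagged squares of b0, b1 and sep get indices 0, 1, 2, i.e. the tape
-- symbols 1, 2, 3 that inSym prescribes.
Square-finite : Finite Square
Square-finite = retract to from (λ _ → refl)
  ((Bool-finite ×-finite (Mark-finite ×-finite Mark-finite)) ×-finite Letter-finite)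
  where
  to : Square → (Bool × Mark × Mark) × Letter
  to (square (cell a x y) l) = (l , x , y) , a
  from : (Bool × Mark × Mark) × Letter → Square
  from ((l , x , y) , a) = square (cell a x y) l

Phase-finite : Finite Phase
Phase-finite = retract to from from-to
  ((Bool-finite ×-finite (Count-finite ×-finite Bool-finite)) ⊎-finite (Bool⁴ ⊎-finite (Bool⁴ ⊎-finite Compare)))
  where
  Bool⁴ : Finite (Bool × Bool × Bool × Bool)
  Bool⁴ = Bool-finite ×-finite (Bool-finite ×-finite (Bool-finite ×-finite Bool-finite))
  Compare : Finite (Bool × Maybe Bool × Maybe Bool × Maybe Bool × Maybe Bool × Bool × Bool × Bool)
  Compare = Bool-finite ×-finite (MaybeBool-finite ×-finite (MaybeBool-finite ×-finite (MaybeBool-finite ×-finite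
            (MaybeBool-finite ×-finite (Bool-finite ×-finite (Bool-finite ×-finite Bool-finite))))))
  to : Phase → _
  to (parse a b c)              = inj₁ (a , b , c)
  to (advanceI a b c d)         = inj₂ (inj₁ (a , b , c , d))
  to (advanceJ a b c d)         = inj₂ (inj₂ (inj₁ (a , b , c , d)))
  to (compare a b c d e f g h)  = inj₂ (inj₂ (inj₂ (a , b , c , d , e , f , g , h)))
  from : _ → Phase
  from (inj₁ (a , b , c))                                    = parse a b c
  from (inj₂ (inj₁ (a , b , c , d)))                         = advanceI a b c d
  from (inj₂ (inj₂ (inj₁ (a , b , c , d))))                  = advanceJ a b c d
  from (inj₂ (inj₂ (inj₂ (a , b , c , d , e , f , g , h)))) = compare a b c d e f g h
  from-to : ∀ s → from (to s) ≡ s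
  from-to (parse _ _ _)             = refl
  from-to (advanceI _ _ _ _)        = refl
  from-to (advanceJ _ _ _ _)        = refl
  from-to (compare _ _ _ _ _ _ _ _) = refl

Mode-finite : Finite Mode
Mode-finite = retract to from (λ { (sweep _) → refl ; (rewind _) → refl }) (Phase-finite ⊎-finite Phase-finite)
  where
  to : Mode → Phase ⊎ Phase
  to (sweep s)  = inj₁ s
  to (rewind s) = inj₂ s
  from : Phase ⊎ Phase → Mode
  from (inj₁ s) = sweep s
  from (inj₂ s) = rewind s

symbolIndex : Symbol → Fin 55
symbolIndex blank       = zero
symbolIndex (written x) = suc (index Square-finite x)

decodeSymbol : Fin 55 → Symbol
decodeSymbol zero    = blank
decodeSymbol (suc k) = written (decode Square-finite k)

decodeSymbol-index : ∀ y → decodeSymbol (symbolIndex y) ≡ y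
decodeSymbol-index blank       = refl
decodeSymbol-index (written x) = cong written (decode-index Square-finite x)

encodeStep : Step → Action (size Mode-finite) 55
encodeStep (halts b)       = halt b
encodeStep (moves m y mv)  = go (index Mode-finite m) (symbolIndex y) mv

machine : TM
machine = record
  { Q     = size Mode-finite
  ; Γ     = 51
  ; start = index Mode-finite (sweep startParse)
  ; δ     = λ q k → encodeStep (transition (decode Mode-finite q) (decodeSymbol k))
  }

δ-index : ∀ m y → δ machine (index Mode-finite m) (symbolIndex y) ≡ encodeStep (transition m y)
δ-index m y rewrite decode-index Mode-finite m | decodeSymbol-index y = refl

inputCell : InSym → Cell
inputCell b0  = cell (bit false) fresh fresh
inputCell b1  = cell (bit true) fresh fresh
inputCell sep = cell separator fresh fresh

inSym-index : ∀ a → inSym machine a ≡ symbolIndex (written (square (inputCell a) false))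
inSym-index b0  = refl
inSym-index b1  = refl
inSym-index sep = refl

pass : ∀ {S A : Set} → (S → A → S × A) → S → List A → S × List A
pass f s []       = s , []
pass f s (a ∷ as) = proj₁ (pass f (proj₁ (f s a)) as) , proj₂ (f s a) ∷ proj₂ (pass f (proj₁ (f s a)) as)

length-pass : ∀ {S A : Set} (f : S → A → S × A) s as → length (proj₂ (pass f s as)) ≡ length as
length-pass f s []       = refl
length-pass f s (a ∷ as) = cong suc (length-pass f _ as)

pass-++ : ∀ {S A : Set} (f : S → A → S × A) s xs ys →
  pass f s (xs ++ ys) ≡
  (proj₁ (pass f (proj₁ (pass f s xs)) ys) , proj₂ (pass f s xs) ++ proj₂ (pass f (proj₁ (pass f s xs)) ys))
pass-++ f s []       ys = refl
pass-++ f s (x ∷ xs) ys rewrite pass-++ f (proj₁ (f s x)) xs ys = refl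

pass-map : ∀ {S A B : Set} {f : S → A → S × A} {g : S → B → S × B} (h : A → B) →
  (∀ s a → g s (h a) ≡ map₂ h (f s a)) → ∀ s as → pass g s (map h as) ≡ map₂ (map h) (pass f s as)
pass-map h commutes s []       = refl
pass-map {f = f} {g} h commutes s (a ∷ as) with g s (h a) | commutes s a
... | _ | refl = cong (λ p → proj₁ p , h (proj₂ (f s a)) ∷ proj₂ p) (pass-map h commutes (proj₁ (f s a)) as)

module RunFacts (M : TM) where

  run-extend : ∀ t e c {b} → run M t c ≡ just b → run M (t + e) c ≡ just b
  run-extend t e ⟨ q , ls , rs ⟩ h with δ M q (headSym {M} rs)
  ... | halt _ = h
  ... | go q′ s m with t
  ...   | suc t′ = run-extend t′ e (move {M} q′ s m ls (tailSym {M} rs)) h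

  run-≤ : ∀ {t t′} c {b} → t ≤ t′ → run M t c ≡ just b → run M t′ c ≡ just b
  run-≤ {t} {t′} c t≤t′ h = subst (λ u → run M u c ≡ just _) (m+[n∸m]≡n t≤t′) (run-extend t _ c h)

  run-cong : ∀ t {q q′ ls rs rs′} →
    δ M q (headSym {M} rs) ≡ δ M q′ (headSym {M} rs′) → tailSym {M} rs ≡ tailSym {M} rs′ →
    run M t ⟨ q , ls , rs ⟩ ≡ run M t ⟨ q′ , ls , rs′ ⟩
  run-cong t {q} {q′} {ls} {rs} {rs′} same-δ same-tail
    with δ M q (headSym {M} rs) | δ M q′ (headSym {M} rs′) | same-δ
  ... | halt _      | _ | refl = refl
  ... | go q″ s m   | _ | refl with t
  ...   | zero   = refl
  ...   | suc t′ = cong (λ r → run M t′ (move {M} q″ s m ls r)) same-tail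

  record Runs (k : ℕ) (c c′ : Config M) : Set where
    constructor runs
    field steps : ∀ e → run M (k + e) c ≡ run M e c′
  open Runs public

  infixr 5 _⨾_
  _⨾_ : ∀ {k k′ c c′ c″} → Runs k c c′ → Runs k′ c′ c″ → Runs (k + k′) c c″
  _⨾_ {k} {k′} {c} (runs p) (runs q) =
    runs λ e → trans (cong (λ u → run M u c) (+-assoc k k′ e)) (trans (p (k′ + e)) (q e))

  step : ∀ t q ls rs {q′ s m} → δ M q (headSym {M} rs) ≡ go q′ s m →
         run M (suc t) ⟨ q , ls , rs ⟩ ≡ run M t (move {M} q′ s m ls (tailSym {M} rs))
  step t q ls rs e with δ M q (headSym {M} rs)
  step t q ls rs refl | _ = refl

  halting : ∀ t q ls rs {b} → δ M q (headSym {M} rs) ≡ halt b → run M t ⟨ q , ls , rs ⟩ ≡ just b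
  halting t q ls rs e with δ M q (headSym {M} rs)
  halting t q ls rs refl | _ = refl

open RunFacts machine

config : Mode → List Symbol → List Symbol → Config machine
config m ls rs = ⟨ index Mode-finite m , map symbolIndex ls , map symbolIndex rs ⟩

step₁ : ∀ m y ls rs {m′ y′ mv} → transition m y ≡ moves m′ y′ mv →
  Runs 1 (config m ls (y ∷ rs))
         (move {machine} (index Mode-finite m′) (symbolIndex y′) mv (map symbolIndex ls) (map symbolIndex rs))
step₁ m y ls rs e = runs λ t →
  step t (index Mode-finite m) (map symbolIndex ls) (map symbolIndex (y ∷ rs)) (trans (δ-index m y) (cong encodeStep e))

passCells : Phase → List Cell → Phase × List Cell
passCells = pass stepCell

passSquares : Phase → List Square → Phase × List Square
passSquares = pass stepSquare

sweep-runs : ∀ s xs ls rs →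
  Runs (length xs) (config (sweep s) ls (map written xs ++ rs))
    (config (sweep (proj₁ (passSquares s xs))) (map written (proj₂ (passSquares s xs)) ʳ++ ls) rs)
sweep-runs s []       ls rs = runs λ _ → refl
sweep-runs s (x ∷ xs) ls rs =
  step₁ (sweep s) (written x) ls (map written xs ++ rs) refl ⨾
  sweep-runs (proj₁ (stepSquare s x)) xs (written (proj₂ (stepSquare s x)) ∷ ls) rs

AtEnd : List Symbol → Set
AtEnd r = r ≡ [] ⊎ r ≡ blank ∷ []

at-blank : ∀ s {e} → endOfPass s ≡ e → δ machine (index Mode-finite (sweep s)) zero ≡ encodeStep (afterPass e)
at-blank s end = trans (δ-index (sweep s) blank) (cong (encodeStep ∘ afterPass) end)

finish-halts : ∀ {s r b} t ls → AtEnd r → endOfPass s ≡ finish b → run machine t (config (sweep s) ls r) ≡ just b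
finish-halts {s} t ls (inj₁ refl) end = halting t (index Mode-finite (sweep s)) (map symbolIndex ls) [] (at-blank s end)
finish-halts {s} t ls (inj₂ refl) end =
  halting t (index Mode-finite (sweep s)) (map symbolIndex ls) (zero ∷ []) (at-blank s end)

continue-rewinds : ∀ {s r s″} ls → AtEnd r → endOfPass s ≡ continue s″ →
  Runs 1 (config (sweep s) ls r) (config (rewind s″) ls (blank ∷ []))
continue-rewinds {s} ls (inj₁ refl) end = runs λ t →
  step t (index Mode-finite (sweep s)) (map symbolIndex ls) [] (at-blank s end)
continue-rewinds {s} ls (inj₂ refl) end = runs λ t →
  step t (index Mode-finite (sweep s)) (map symbolIndex ls) (zero ∷ []) (at-blank s end)

data Passable : Symbol → Set where
  over-blank     : Passable blank
  over-unflagged : ∀ c → Passable (written (square c false))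

passes-left : ∀ {s y} → Passable y → transition (rewind s) y ≡ moves (rewind s) y L
passes-left over-blank         = refl
passes-left (over-unflagged _) = refl

Runs-cast : ∀ {k k′ c c′} → k ≡ k′ → Runs k c c′ → Runs k′ c c′
Runs-cast refl r = r

rewind-runs : ∀ s t us acc y rr → All Passable us → Passable y →
  Runs (length (t ∷ us)) (config (rewind s) ((t ∷ us) ʳ++ acc) (y ∷ rr))
                         (config (rewind s) acc (t ∷ us ++ y ∷ rr))
rewind-runs s t []       acc y rr []         py = step₁ (rewind s) y (t ∷ acc) rr (passes-left py)
rewind-runs s t (u ∷ us) acc y rr (pu ∷ pus) py = Runs-cast (+-comm (length (u ∷ us)) 1)
  (rewind-runs s u us (t ∷ acc) y rr pus py ⨾ step₁ (rewind s) u (t ∷ acc) (us ++ y ∷ rr) (passes-left pu))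

rewind≈sweep : ∀ {s x} t rs → leftmost x ≡ true →
  run machine t (config (rewind s) [] (written x ∷ rs)) ≡ run machine t (config (sweep s) [] (written x ∷ rs))
rewind≈sweep {s} {square c .true} t rs refl =
  run-cong t {index Mode-finite (rewind s)} {index Mode-finite (sweep s)} {[]} {y ∷ map symbolIndex rs} {y ∷ map symbolIndex rs}
    (trans (δ-index (rewind s) (written (square c true))) (sym (δ-index (sweep s) (written (square c true))))) refl
  where
  y : Fin 55
  y = symbolIndex (written (square c true))

Unflagged : Square → Set
Unflagged x = leftmost x ≡ false

unflagged-passable : ∀ {x} → Unflagged x → Passable (written x)
unflagged-passable {square c .false} refl = over-unflagged c

-- n steps of the sweep, one at the blank, and n steps back.
passCost : ℕ → ℕ
passCost n = n + suc n

round : ∀ s xs r {s′ x rest s″} → AtEnd r → passSquares s xs ≡ (s′ , x ∷ rest) → endOfPass s′ ≡ continue s″ →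
  leftmost x ≡ true → All Unflagged rest →
  Runs (passCost (length xs)) (config (sweep s) [] (map written xs ++ r))
                              (config (sweep s″) [] (map written (x ∷ rest) ++ blank ∷ []))
round s xs r {s′} {x} {rest} {s″} at-end eq cont x-leftmost rest-unflagged =
  Runs-cast (cong (λ n → length xs + suc n) same-length)
    (sweeping ⨾ continue-rewinds {s′} (map written (x ∷ rest) ʳ++ []) at-end cont ⨾ rewinding)
  where
  origin : Config machine
  origin = config (sweep s) [] (map written xs ++ r)
  sweeping : Runs (length xs) origin (config (sweep s′) (map written (x ∷ rest) ʳ++ []) r)
  sweeping = subst (λ p → Runs (length xs) origin (config (sweep (proj₁ p)) (map written (proj₂ p) ʳ++ []) r))
                   eq (sweep-runs s xs [] r)
  rewinding : Runs (length (written x ∷ map written rest))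
    (config (rewind s″) (map written (x ∷ rest) ʳ++ []) (blank ∷ []))
    (config (sweep s″) [] (map written (x ∷ rest) ++ blank ∷ []))
  rewinding with rewind-runs s″ (written x) (map written rest) [] blank []
                   (All-map⁺ (All.map unflagged-passable rest-unflagged)) over-blank
  ... | runs r = runs λ e → trans (r e) (rewind≈sweep {s″} {x} e (map written rest ++ blank ∷ []) x-leftmost)
  same-length : length (written x ∷ map written rest) ≡ length xs
  same-length = trans (cong suc (length-map written rest))
                      (trans (cong (length ∘ proj₂) (sym eq)) (length-pass stepSquare s xs))

passCells-content : ∀ s xs → passCells s (map content xs) ≡ map₂ (map content) (passSquares s xs)
passCells-content = pass-map content (λ _ _ → refl)

data Scanning : Phase → Set where
  advancingI : ∀ {a b c d} → Scanning (advanceI a b c d)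
  advancingJ : ∀ {a b c d} → Scanning (advanceJ a b c d)
  comparing  : ∀ {a b c d e f g h} → Scanning (compare a b c d e f g h)

stepCell-scanning : ∀ {s} c → Scanning s → Scanning (proj₁ (stepCell s c))
stepCell-scanning (cell (bit _) _ _) advancingI = advancingI
stepCell-scanning {advanceI true _ _ _} (cell separator _ _) advancingI = advancingI
stepCell-scanning {advanceI false _ _ _} (cell separator _ _) advancingI = advancingI
stepCell-scanning (cell (bit _) _ _) advancingJ = advancingJ
stepCell-scanning {advanceJ true _ _ _} (cell separator _ _) advancingJ = advancingJ
stepCell-scanning {advanceJ false _ _ _} (cell separator _ _) advancingJ = advancingJ
stepCell-scanning (cell (bit _) _ _) comparing = comparing
stepCell-scanning {compare true _ _ _ _ _ _ _} (cell separator _ _) comparing = comparing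
stepCell-scanning {compare false _ _ _ _ _ _ _} (cell separator _ _) comparing = comparing

leftmostAfter-scanning : ∀ {s} l → Scanning s → leftmostAfter s l ≡ l
leftmostAfter-scanning l advancingI = refl
leftmostAfter-scanning l advancingJ = refl
leftmostAfter-scanning l comparing  = refl

continue-scanning : ∀ s {s″} → endOfPass s ≡ continue s″ → Scanning s″
continue-scanning (parse _ several true)      refl = advancingI
continue-scanning (advanceI _ _ true false)   refl = advancingJ
continue-scanning (advanceJ _ _ false false)  refl = advancingI
continue-scanning (advanceJ _ _ true false)   refl = comparing
continue-scanning (compare _ _ _ vi vj sij si sj) e with pairOK vi vj sij si sj
continue-scanning (compare _ _ _ _ _ _ _ _) refl | true = advancingJ
continue-scanning (parse _ none _)            ()
continue-scanning (parse _ one _)             ()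
continue-scanning (parse _ several false)     ()
continue-scanning (advanceI _ _ _ true)       ()
continue-scanning (advanceI _ _ false false)  ()
continue-scanning (advanceJ _ _ _ true)       ()

data Marked : List Square → Set where
  marked : ∀ {x rest} → leftmost x ≡ true → All Unflagged rest → Marked (x ∷ rest)

scanning-keeps-unflagged : ∀ {s} xs → Scanning s → All Unflagged xs → All Unflagged (proj₂ (passSquares s xs))
scanning-keeps-unflagged []       _  []       = []
scanning-keeps-unflagged (x ∷ xs) sc (u ∷ us) =
  trans (leftmostAfter-scanning _ sc) u ∷ scanning-keeps-unflagged xs (stepCell-scanning (content x) sc) us

scanning-keeps-marked : ∀ {s} xs → Scanning s → Marked xs → Marked (proj₂ (passSquares s xs))
scanning-keeps-marked (x ∷ xs) sc (marked l us) =
  marked (trans (leftmostAfter-scanning _ sc) l) (scanning-keeps-unflagged xs (stepCell-scanning (content x) sc) us)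

parsing-unflags : ∀ c e xs → All Unflagged (proj₂ (passSquares (parse false c e) xs))
parsing-unflags c e []                                  = []
parsing-unflags c e (square (cell (bit _) _ _) _ ∷ xs)   = refl ∷ parsing-unflags c false xs
parsing-unflags c e (square (cell separator _ _) _ ∷ xs) = refl ∷ parsing-unflags (next c) true xs

parsing-marks : ∀ c e x xs → Marked (proj₂ (passSquares (parse true c e) (x ∷ xs)))
parsing-marks c e (square (cell (bit _) _ _) _) xs   = marked refl (parsing-unflags c false xs)
parsing-marks c e (square (cell separator _ _) _) xs = marked refl (parsing-unflags (next c) true xs)

runPasses : ℕ → Phase → List Cell → Maybe Bool
continueFrom : ℕ → PassEnd → List Cell → Maybe Bool
runPasses zero    s cs = nothing
runPasses (suc k) s cs = continueFrom k (endOfPass (proj₁ (passCells s cs))) (proj₂ (passCells s cs))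
continueFrom k (finish b)   cs = just b
continueFrom k (continue s) cs = runPasses k s cs

round-halts : ∀ s xs r t {b} → AtEnd r → endOfPass (proj₁ (passSquares s xs)) ≡ finish b →
  run machine (length xs + t) (config (sweep s) [] (map written xs ++ r)) ≡ just b
round-halts s xs r t at-end end = trans (steps (sweep-runs s xs [] r) t)
  (finish-halts {proj₁ (passSquares s xs)} t (map written (proj₂ (passSquares s xs)) ʳ++ []) at-end end)

passes-run : ∀ k s xs r {b} → AtEnd r → Marked (proj₂ (passSquares s xs)) → runPasses k s (map content xs) ≡ just b →
  run machine (k * passCost (length xs)) (config (sweep s) [] (map written xs ++ r)) ≡ just b
after-pass : ∀ k s xs r {b} → AtEnd r → Marked (proj₂ (passSquares s xs)) →
  continueFrom k (endOfPass (proj₁ (passSquares s xs))) (map content (proj₂ (passSquares s xs))) ≡ just b →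
  run machine (suc k * passCost (length xs)) (config (sweep s) [] (map written xs ++ r)) ≡ just b

passes-run (suc k) s xs r at-end m h = after-pass k s xs r at-end m
  (subst (λ p → continueFrom k (endOfPass (proj₁ p)) (proj₂ p) ≡ just _) (passCells-content s xs) h)

after-pass k s xs r at-end m h with passSquares s xs in eq
... | s′ , x ∷ rest with m | endOfPass s′ in end
...   | marked x-leftmost rest-unflagged | finish _ with h
...     | refl =
  trans (cong (λ t → run machine t (config (sweep s) [] (map written xs ++ r)))
              (+-assoc (length xs) (suc (length xs)) (k * passCost (length xs))))
        (round-halts s xs r (suc (length xs) + k * passCost (length xs)) at-end (trans (cong (endOfPass ∘ proj₁) eq) end))
after-pass k s xs r at-end m h | s′ , x ∷ rest | marked x-leftmost rest-unflagged | continue s″ =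
  trans (steps (round s xs r at-end eq end x-leftmost rest-unflagged) (k * passCost (length xs)))
    (subst (λ n → run machine (k * passCost n) (config (sweep s″) [] (map written (x ∷ rest) ++ blank ∷ [])) ≡ just _)
      same-length
      (passes-run k s″ (x ∷ rest) (blank ∷ []) (inj₂ refl)
        (scanning-keeps-marked (x ∷ rest) (continue-scanning s′ end) (marked x-leftmost rest-unflagged)) h))
  where
  same-length : length (x ∷ rest) ≡ length xs
  same-length = trans (cong (length ∘ proj₂) (sym eq)) (length-pass stepSquare s xs)

inputSquares : List InSym → List Square
inputSquares = map (λ a → square (inputCell a) false)

initial-config : ∀ w → initial machine w ≡ config (sweep startParse) [] (map written (inputSquares w) ++ [])
initial-config w = cong (λ rs → ⟨ index Mode-finite (sweep startParse) , [] , rs ⟩) (encode-input w)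
  where
  encode-input : ∀ w → map (inSym machine) w ≡ map symbolIndex (map written (inputSquares w) ++ [])
  encode-input []      = refl
  encode-input (a ∷ w) = cong₂ _∷_ (inSym-index a) (encode-input w)

initial-run : ∀ k w {b} → runPasses k startParse (map inputCell w) ≡ just b →
  run machine (k * passCost (length w)) (initial machine w) ≡ just b
initial-run (suc k) [] refl = finish-halts {startParse} (suc k * passCost 0) [] (inj₁ refl) refl
initial-run k (a ∷ w) {b} h =
  subst (λ c → run machine (k * passCost (length (a ∷ w))) c ≡ just b) (sym (initial-config (a ∷ w))) running
  where
  xs : List Square
  xs = inputSquares (a ∷ w)
  running : run machine (k * passCost (length (a ∷ w))) (config (sweep startParse) [] (map written xs ++ [])) ≡ just b
  running = subst (λ n → run machine (k * passCost n) (config (sweep startParse) [] (map written xs ++ [])) ≡ just b)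
    (length-map _ (a ∷ w))
    (passes-run k startParse xs [] (inj₁ refl) (parsing-marks none true (square (inputCell a) false) (inputSquares w))
      (subst (λ cs → runPasses k startParse cs ≡ just b) (map-∘ (a ∷ w)) h))

-- Passes over a tape of blocks

markFor : ℕ → Mark
markFor zero          = fresh
markFor (suc zero)    = current
markFor (suc (suc _)) = passed

-- A block bs whose i- and j-counters stand at k and l.
blockCells : ℕ → ℕ → List Bool → List Cell
blockCells k l []       = cell separator fresh fresh ∷ []
blockCells k l (b ∷ bs) = cell (bit b) (markFor k) (markFor l) ∷ blockCells (pred k) (pred l) bs

tapeCells : ℕ → ℕ → List (List Bool) → List Cell
tapeCells k l []       = []
tapeCells k l (bs ∷ B) = blockCells k l bs ++ tapeCells k l B

inRange : ℕ → List Bool → Bool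
inRange k       []       = false
inRange zero    (_ ∷ _)  = true
inRange (suc k) (_ ∷ bs) = inRange k bs

closeI : Bool → Bool → Bool → Bool → Phase
closeI true  carry f bad = advanceI false false carry bad
closeI false carry f bad = advanceI false false f (bad ∨ (carry xor f))

closeJ : Bool → Bool → Bool → Bool → Phase
closeJ true  carry f bad = advanceJ false false carry bad
closeJ false carry f bad = advanceJ false false f (bad ∨ (carry xor f))

advanceI-carried : ∀ l bs first f bad →
  passCells (advanceI first true f bad) (blockCells 0 l bs) ≡ (closeI first true f bad , blockCells 0 0 bs)
advanceI-carried l []       true  f bad = refl
advanceI-carried l []       false f bad = refl
advanceI-carried l (b ∷ bs) first f bad rewrite advanceI-carried (pred l) bs first f bad = refl

advanceI-block : ∀ k l bs first f bad →
  passCells (advanceI first false f bad) (blockCells k l bs) ≡ (closeI first (inRange k bs) f bad , blockCells (suc k) 0 bs)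
advanceI-block zero          l []       true  f bad = refl
advanceI-block (suc k)       l []       true  f bad = refl
advanceI-block zero          l []       false f bad = refl
advanceI-block (suc k)       l []       false f bad = refl
advanceI-block zero          l (b ∷ bs) first f bad rewrite advanceI-carried (pred l) bs first f bad = refl
advanceI-block (suc zero)    l (b ∷ bs) first f bad rewrite advanceI-block zero (pred l) bs first f bad = refl
advanceI-block (suc (suc k)) l (b ∷ bs) first f bad rewrite advanceI-block (suc k) (pred l) bs first f bad = refl

advanceJ-carried : ∀ k bs first f bad →
  passCells (advanceJ first true f bad) (blockCells k 0 bs) ≡ (closeJ first true f bad , blockCells k 0 bs)
advanceJ-carried k []       true  f bad = refl
advanceJ-carried k []       false f bad = refl
advanceJ-carried k (b ∷ bs) first f bad rewrite advanceJ-carried (pred k) bs first f bad = refl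

advanceJ-block : ∀ k l bs first f bad →
  passCells (advanceJ first false f bad) (blockCells k l bs) ≡ (closeJ first (inRange l bs) f bad , blockCells k (suc l) bs)
advanceJ-block k zero          []       true  f bad = refl
advanceJ-block k (suc l)       []       true  f bad = refl
advanceJ-block k zero          []       false f bad = refl
advanceJ-block k (suc l)       []       false f bad = refl
advanceJ-block k zero          (b ∷ bs) first f bad rewrite advanceJ-carried (pred k) bs first f bad = refl
advanceJ-block k (suc zero)    (b ∷ bs) first f bad rewrite advanceJ-block (pred k) zero bs first f bad = refl
advanceJ-block k (suc (suc l)) (b ∷ bs) first f bad rewrite advanceJ-block (pred k) (suc l) bs first f bad = refl

lookupOr : Maybe Bool → List Bool → ℕ → Maybe Bool
lookupOr a []       p       = a
lookupOr a (b ∷ bs) zero    = just b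
lookupOr a (b ∷ bs) (suc p) = lookupOr a bs p

readCounter : Maybe Bool → ℕ → List Bool → Maybe Bool
readCounter a zero    bs = a
readCounter a (suc p) bs = lookupOr a bs p

readCounter-step : ∀ a k b bs → readCounter (readMarked a (markFor k) b) (pred k) bs ≡ readCounter a k (b ∷ bs)
readCounter-step a zero          b bs = refl
readCounter-step a (suc zero)    b bs = refl
readCounter-step a (suc (suc k)) b bs = refl

closeCompare : Bool → Maybe Bool → Maybe Bool → Maybe Bool → Maybe Bool → Bool → Bool → Bool → Phase
closeCompare true  a b vi vj sij si sj = compare false nothing nothing a b sij si sj
closeCompare false a b vi vj sij si sj =
  compare false nothing nothing vi vj (sij ∨ (isTrue a ∧ isFalse b)) (si ∨ isTrue a) (sj ∨ isFalse b)

compare-block : ∀ k l bs first a b vi vj sij si sj →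
  passCells (compare first a b vi vj sij si sj) (blockCells k l bs) ≡
  (closeCompare first (readCounter a k bs) (readCounter b l bs) vi vj sij si sj , blockCells k l bs)
compare-block zero    zero    [] true  a b vi vj sij si sj = refl
compare-block zero    zero    [] false a b vi vj sij si sj = refl
compare-block zero    (suc l) [] true  a b vi vj sij si sj = refl
compare-block zero    (suc l) [] false a b vi vj sij si sj = refl
compare-block (suc k) zero    [] true  a b vi vj sij si sj = refl
compare-block (suc k) zero    [] false a b vi vj sij si sj = refl
compare-block (suc k) (suc l) [] true  a b vi vj sij si sj = refl
compare-block (suc k) (suc l) [] false a b vi vj sij si sj = refl
compare-block k l (x ∷ bs) first a b vi vj sij si sj
  rewrite compare-block (pred k) (pred l) bs first (readMarked a (markFor k) x) (readMarked b (markFor l) x) vi vj sij si sj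
        | readCounter-step a k x bs | readCounter-step b l x bs = refl

mismatch : ℕ → Bool → Bool → List (List Bool) → Bool
mismatch k f bad []       = bad
mismatch k f bad (r ∷ rs) = mismatch k f (bad ∨ (inRange k r xor f)) rs

advanceI-rows : ∀ k l rows f bad →
  passCells (advanceI false false f bad) (tapeCells k l rows) ≡
  (advanceI false false f (mismatch k f bad rows) , tapeCells (suc k) 0 rows)
advanceI-rows k l []         f bad = refl
advanceI-rows k l (r ∷ rows) f bad
  rewrite pass-++ stepCell (advanceI false false f bad) (blockCells k l r) (tapeCells k l rows)
        | advanceI-block k l r false f bad | advanceI-rows k l rows f (bad ∨ (inRange k r xor f)) = refl

advanceI-tape : ∀ k l v rows → passCells startI (tapeCells k l (v ∷ rows)) ≡
  (advanceI false false (inRange k v) (mismatch k (inRange k v) false rows) , tapeCells (suc k) 0 (v ∷ rows))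
advanceI-tape k l v rows
  rewrite pass-++ stepCell startI (blockCells k l v) (tapeCells k l rows)
        | advanceI-block k l v true false false | advanceI-rows k l rows (inRange k v) false = refl

advanceJ-rows : ∀ k l rows f bad →
  passCells (advanceJ false false f bad) (tapeCells k l rows) ≡
  (advanceJ false false f (mismatch l f bad rows) , tapeCells k (suc l) rows)
advanceJ-rows k l []         f bad = refl
advanceJ-rows k l (r ∷ rows) f bad
  rewrite pass-++ stepCell (advanceJ false false f bad) (blockCells k l r) (tapeCells k l rows)
        | advanceJ-block k l r false f bad | advanceJ-rows k l rows f (bad ∨ (inRange l r xor f)) = refl

advanceJ-tape : ∀ k l v rows → passCells startJ (tapeCells k l (v ∷ rows)) ≡
  (advanceJ false false (inRange l v) (mismatch l (inRange l v) false rows) , tapeCells k (suc l) (v ∷ rows))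
advanceJ-tape k l v rows
  rewrite pass-++ stepCell startJ (blockCells k l v) (tapeCells k l rows)
        | advanceJ-block k l v true false false | advanceJ-rows k l rows (inRange l v) false = refl

anyFrom : (List Bool → Bool) → Bool → List (List Bool) → Bool
anyFrom f x []       = x
anyFrom f x (r ∷ rs) = anyFrom f (x ∨ f r) rs

trueAt falseAt : ℕ → List Bool → Bool
trueAt  p r = isTrue (lookupOr nothing r p)
falseAt q r = isFalse (lookupOr nothing r q)

separatesAt : ℕ → ℕ → List Bool → Bool
separatesAt p q r = trueAt p r ∧ falseAt q r

compare-rows : ∀ p q rows vi vj x y z →
  passCells (compare false nothing nothing vi vj x y z) (tapeCells (suc p) (suc q) rows) ≡
  (compare false nothing nothing vi vj
     (anyFrom (separatesAt p q) x rows) (anyFrom (trueAt p) y rows) (anyFrom (falseAt q) z rows) ,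
   tapeCells (suc p) (suc q) rows)
compare-rows p q []         vi vj x y z = refl
compare-rows p q (r ∷ rows) vi vj x y z
  rewrite pass-++ stepCell (compare false nothing nothing vi vj x y z)
            (blockCells (suc p) (suc q) r) (tapeCells (suc p) (suc q) rows)
        | compare-block (suc p) (suc q) r false nothing nothing vi vj x y z
        | compare-rows p q rows vi vj (x ∨ separatesAt p q r) (y ∨ trueAt p r) (z ∨ falseAt q r) = refl

pairCheck : ℕ → ℕ → List Bool → List (List Bool) → Bool
pairCheck p q v rows = pairOK (lookupOr nothing v p) (lookupOr nothing v q)
  (anyFrom (separatesAt p q) false rows) (anyFrom (trueAt p) false rows) (anyFrom (falseAt q) false rows)

compare-tape : ∀ p q v rows → passCells startCompare (tapeCells (suc p) (suc q) (v ∷ rows)) ≡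
  (compare false nothing nothing (lookupOr nothing v p) (lookupOr nothing v q)
    (anyFrom (separatesAt p q) false rows) (anyFrom (trueAt p) false rows) (anyFrom (falseAt q) false rows) ,
   tapeCells (suc p) (suc q) (v ∷ rows))
compare-tape p q v rows
  rewrite pass-++ stepCell startCompare (blockCells (suc p) (suc q) v) (tapeCells (suc p) (suc q) rows)
        | compare-block (suc p) (suc q) v true nothing nothing nothing nothing false false false
        | compare-rows p q rows (lookupOr nothing v p) (lookupOr nothing v q) false false false = refl

consBit : Bool → List (List Bool) × List Bool → List (List Bool) × List Bool
consBit b ([]     , t) = [] , b ∷ t
consBit b (c ∷ B , t) = (b ∷ c) ∷ B , t

-- The blocks terminated by a separator, and the bits after the last separator.
splitBlocks : List InSym → List (List Bool) × List Bool
splitBlocks []        = [] , []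
splitBlocks (sep ∷ w) = [] ∷ proj₁ (splitBlocks w) , proj₂ (splitBlocks w)
splitBlocks (b0 ∷ w)  = consBit false (splitBlocks w)
splitBlocks (b1 ∷ w)  = consBit true (splitBlocks w)

encodeBlock : List Bool → List InSym
encodeBlock bs = map encBit bs ++ sep ∷ []

iterateNext : Count → ℕ → Count
iterateNext c zero    = c
iterateNext c (suc n) = iterateNext (next c) n

parsedPhase : Bool → Count → Bool → List (List Bool) × List Bool → Phase
parsedPhase a c e (B , t) = parse a (iterateNext c (length B)) (null t ∧ (not (null B) ∨ e))

parse-bit : ∀ b c e w →
  proj₁ (passCells (parse false c false) (map inputCell w)) ≡ parsedPhase (null w ∧ false) c false (splitBlocks w) →
  proj₁ (passCells (parse false c false) (map inputCell w)) ≡ parsedPhase false c e (consBit b (splitBlocks w))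
parse-bit b c e w ih with splitBlocks w
... | []    , t rewrite ih | ∧-zeroʳ (null w) | ∧-zeroʳ (null t) = refl
... | _ ∷ _ , t rewrite ih | ∧-zeroʳ (null w) = refl

parse-phase : ∀ a c e w →
  proj₁ (passCells (parse a c e) (map inputCell w)) ≡ parsedPhase (null w ∧ a) c e (splitBlocks w)
parse-phase a c e []        = refl
parse-phase a c e (sep ∷ w) rewrite parse-phase false (next c) true w | ∧-zeroʳ (null w)
  | ∨-zeroʳ (not (null (proj₁ (splitBlocks w)))) = refl
parse-phase a c e (b0 ∷ w) = parse-bit false c e w (parse-phase false c false w)
parse-phase a c e (b1 ∷ w) = parse-bit true c e w (parse-phase false c false w)

parse-keeps-tape : ∀ a c e w → proj₂ (passCells (parse a c e) (map inputCell w)) ≡ map inputCell w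
parse-keeps-tape a c e []        = refl
parse-keeps-tape a c e (sep ∷ w) = cong (_ ∷_) (parse-keeps-tape false (next c) true w)
parse-keeps-tape a c e (b0 ∷ w)  = cong (_ ∷_) (parse-keeps-tape false c false w)
parse-keeps-tape a c e (b1 ∷ w)  = cong (_ ∷_) (parse-keeps-tape false c false w)

joinBlocks : List (List Bool) × List Bool → List InSym
joinBlocks (B , t) = concatMap encodeBlock B ++ map encBit t

consBit-sound : ∀ b w → w ≡ joinBlocks (splitBlocks w) → encBit b ∷ w ≡ joinBlocks (consBit b (splitBlocks w))
consBit-sound b w ih with splitBlocks w
... | []    , t = cong (encBit b ∷_) ih
... | _ ∷ _ , t = cong (encBit b ∷_) ih

splitBlocks-sound : ∀ w → w ≡ joinBlocks (splitBlocks w)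
splitBlocks-sound []        = refl
splitBlocks-sound (sep ∷ w) = cong (sep ∷_) (splitBlocks-sound w)
splitBlocks-sound (b0 ∷ w)  = consBit-sound false w (splitBlocks-sound w)
splitBlocks-sound (b1 ∷ w)  = consBit-sound true w (splitBlocks-sound w)

splitBlocks-block : ∀ bs w →
  splitBlocks (map encBit bs ++ sep ∷ w) ≡ (bs ∷ proj₁ (splitBlocks w) , proj₂ (splitBlocks w))
splitBlocks-block []           w = refl
splitBlocks-block (false ∷ bs) w rewrite splitBlocks-block bs w = refl
splitBlocks-block (true ∷ bs)  w rewrite splitBlocks-block bs w = refl

splitBlocks-encode : ∀ B → splitBlocks (concatMap encodeBlock B) ≡ (B , [])
splitBlocks-encode []      = refl
splitBlocks-encode (bs ∷ B)
  rewrite ++-assoc (map encBit bs) (sep ∷ []) (concatMap encodeBlock B)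
        | splitBlocks-block bs (concatMap encodeBlock B) | splitBlocks-encode B = refl

inputCells-block : ∀ bs w → map inputCell (map encBit bs ++ sep ∷ w) ≡ blockCells 0 0 bs ++ map inputCell w
inputCells-block []           w = refl
inputCells-block (false ∷ bs) w = cong (_ ∷_) (inputCells-block bs w)
inputCells-block (true ∷ bs)  w = cong (_ ∷_) (inputCells-block bs w)

inputCells-encode : ∀ B → map inputCell (concatMap encodeBlock B) ≡ tapeCells 0 0 B
inputCells-encode []       = refl
inputCells-encode (bs ∷ B)
  rewrite ++-assoc (map encBit bs) (sep ∷ []) (concatMap encodeBlock B)
        | inputCells-block bs (concatMap encodeBlock B) | inputCells-encode B = refl

-- The loop over pairs of positions

inRange⇒< : ∀ k bs → inRange k bs ≡ true → k < length bs
inRange⇒< zero    (_ ∷ _)  _ = s≤s z≤n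
inRange⇒< (suc k) (_ ∷ bs) e = s≤s (inRange⇒< k bs e)

<⇒inRange : ∀ k bs → k < length bs → inRange k bs ≡ true
<⇒inRange zero    (_ ∷ _)  _         = refl
<⇒inRange (suc k) (_ ∷ bs) (s≤s k<n) = <⇒inRange k bs k<n

¬inRange⇒≥ : ∀ k bs → inRange k bs ≡ false → length bs ≤ k
¬inRange⇒≥ zero    []       _ = z≤n
¬inRange⇒≥ (suc k) []       _ = z≤n
¬inRange⇒≥ (suc k) (_ ∷ bs) e = s≤s (¬inRange⇒≥ k bs e)

≥⇒¬inRange : ∀ k bs → length bs ≤ k → inRange k bs ≡ false
≥⇒¬inRange zero    []       _         = refl
≥⇒¬inRange (suc k) []       _         = refl
≥⇒¬inRange (suc k) (_ ∷ bs) (s≤s n≤k) = ≥⇒¬inRange k bs n≤k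

mismatch-false : ∀ k f bad rs → mismatch k f bad rs ≡ false → bad ≡ false × All (λ r → inRange k r ≡ f) rs
mismatch-false k f bad []       e = e , []
mismatch-false k f bad (r ∷ rs) e with mismatch-false k f (bad ∨ (inRange k r xor f)) rs e
... | no-bad , agree with bad | inRange k r xor f in differs
...   | false | false = refl , xor-≡false _ _ differs ∷ agree

agree⇒¬mismatch : ∀ k f rs → All (λ r → inRange k r ≡ f) rs → mismatch k f false rs ≡ false
agree⇒¬mismatch k f []       []         = refl
agree⇒¬mismatch k f (r ∷ rs) (e ∷ agree) rewrite e | xor-same f = agree⇒¬mismatch k f rs agree

runPasses-step : ∀ K {s cs s′ cs′} → passCells s cs ≡ (s′ , cs′) →
  runPasses (suc K) s cs ≡ continueFrom K (endOfPass s′) cs′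
runPasses-step K eq rewrite eq = refl

record Decides (k : ℕ) (s : Phase) (cs : List Cell) (P : Set) : Set where
  constructor decides
  field
    answer   : Bool
    within   : ∀ e → runPasses (k + e) s cs ≡ just answer
    sound    : answer ≡ true → P
    complete : P → answer ≡ true

decides-finish : ∀ {K s cs s′ cs′ P} b → passCells s cs ≡ (s′ , cs′) → endOfPass s′ ≡ finish b →
  (b ≡ true → P) → (P → b ≡ true) → Decides (suc K) s cs P
decides-finish {K} b pass-eq end =
  decides b (λ e → trans (runPasses-step (K + e) pass-eq) (cong (λ z → continueFrom (K + e) z _) end))

decides-continue : ∀ {K s cs s′ cs′ s″ P} → passCells s cs ≡ (s′ , cs′) → endOfPass s′ ≡ continue s″ →
  Decides K s″ cs′ P → Decides (suc K) s cs P
decides-continue {K} pass-eq end (decides b within sound complete) =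
  decides b (λ e → trans (runPasses-step (K + e) pass-eq) (trans (cong (λ z → continueFrom (K + e) z _) end) (within e)))
            sound complete

decides-⇔ : ∀ {K s cs P P′} → Decides K s cs P → (P → P′) → (P′ → P) → Decides K s cs P′
decides-⇔ (decides b within sound complete) to from = decides b within (λ e → to (sound e)) (λ p → complete (from p))

double : ℕ → ℕ
double zero    = zero
double (suc n) = suc (suc (double n))

-- With r positions of i left on blocks of length n: one pass to move i, then two passes (move j, compare)
-- for each of the n positions of j, and a last pass of j.
iPasses : ℕ → ℕ → ℕ
iPasses n zero    = 1
iPasses n (suc r) = suc (double n + suc (iPasses n r))

module Loop (v : List Bool) (rs : List (List Bool)) where

  n : ℕ
  n = length v

  rows : List (List Bool)
  rows = v ∷ rs

  SameLength : Set
  SameLength = All (λ r → length r ≡ n) rs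

  -- Moving a counter only reveals whether each block is longer than it; AtLeast accumulates this, so that
  -- once the counter passes the end of the first block all blocks are known to have its length.
  AtLeast : ℕ → Set
  AtLeast k = All (λ r → k ≤ length r) rows

  PairsFrom : ℕ → Set
  PairsFrom k = ∀ p q → k ≤ p → p < n → q < n → pairCheck p q v rs ≡ true

  PairsWith : ℕ → ℕ → Set
  PairsWith p l = ∀ q → l ≤ q → q < n → pairCheck p q v rs ≡ true

  same-length-agree : ∀ k → SameLength → All (λ r → inRange k r ≡ inRange k v) rs
  same-length-agree k = All.map (λ {r} → agree r)
    where
    agree : ∀ r → length r ≡ n → inRange k r ≡ inRange k v
    agree r same with inRange k v in e
    ... | true  = <⇒inRange k r (subst (k <_) (sym same) (inRange⇒< k v e))
    ... | false = ≥⇒¬inRange k r (subst (_≤ k) (sym same) (¬inRange⇒≥ k v e))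

  mismatch⇒¬SameLength : ∀ k → mismatch k (inRange k v) false rs ≡ true → SameLength → ⊥
  mismatch⇒¬SameLength k bad same with trans (sym bad) (agree⇒¬mismatch k (inRange k v) rs (same-length-agree k same))
  ... | ()

  extend-AtLeast : ∀ k → k < n → All (λ r → inRange k r ≡ true) rs → AtLeast (suc k)
  extend-AtLeast k k<n agree = k<n ∷ All.map (λ {r} e → inRange⇒< k r e) agree

  AtLeast⇒SameLength : AtLeast n → All (λ r → inRange n r ≡ false) rs → SameLength
  AtLeast⇒SameLength (_ ∷ long) short = All.zipWith (λ {r} (n≤r , e) → ≤-antisym (¬inRange⇒≥ n r e) n≤r) (long , short)

  end-of-range : ∀ k → k + 0 ≡ n → inRange k v ≡ false
  end-of-range k e = ≥⇒¬inRange k v (subst (_≤ k) (trans (sym (+-identityʳ k)) e) ≤-refl)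

  in-range : ∀ k r → k + suc r ≡ n → k < n
  in-range k r e = subst (suc k ≤_) (trans (sym (+-suc k r)) e) (s≤s (m≤m+n k r))

  AtLeast-zero : AtLeast 0
  AtLeast-zero = All.universal (λ _ → z≤n) rows

  module _ (p : ℕ) {K : ℕ}
           (next-i : ∀ l → Decides K startI (tapeCells (suc p) l rows) (SameLength × PairsFrom (suc p))) where

    j-loop : ∀ r l → l + r ≡ n → AtLeast l →
      Decides (double r + suc K) startJ (tapeCells (suc p) l rows) (SameLength × PairsWith p l × PairsFrom (suc p))
    j-loop zero l l+0≡n _ with mismatch l (inRange l v) false rs in bad
    ... | true = decides-finish false (advanceJ-tape (suc p) l v rs)
          (cong₂ (λ f z → endOfPass (advanceJ false false f z)) (end-of-range l l+0≡n) bad)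
          (λ ()) (λ (same , _) → ⊥-elim (mismatch⇒¬SameLength l bad same))
    ... | false = decides-continue (advanceJ-tape (suc p) l v rs)
          (cong₂ (λ f z → endOfPass (advanceJ false false f z)) (end-of-range l l+0≡n) bad)
          (decides-⇔ (next-i (suc l)) (λ (same , pf) → same , none-left , pf) (λ (same , _ , pf) → same , pf))
      where
      none-left : PairsWith p l
      none-left q l≤q q<n = ⊥-elim (<-irrefl refl (≤-trans q<n (subst (_≤ q) (trans (sym (+-identityʳ l)) l+0≡n) l≤q)))
    j-loop (suc r) l eqn atleast with mismatch l (inRange l v) false rs in bad
    ... | true = decides-finish false (advanceJ-tape (suc p) l v rs)
          (cong₂ (λ f z → endOfPass (advanceJ false false f z)) (<⇒inRange l v l<n) bad)
          (λ ()) (λ (same , _) → ⊥-elim (mismatch⇒¬SameLength l bad same))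
      where
      l<n : l < n
      l<n = in-range l r eqn
    ... | false with pairCheck p l v rs in ok
    ...   | false = decides-continue (advanceJ-tape (suc p) l v rs)
            (cong₂ (λ f z → endOfPass (advanceJ false false f z)) (<⇒inRange l v l<n) bad)
            (decides-finish false (compare-tape p l v rs) (cong (λ z → if z then continue startJ else finish false) ok)
              (λ ()) (λ (_ , pw , _) → trans (sym ok) (pw l ≤-refl l<n)))
      where
      l<n : l < n
      l<n = in-range l r eqn
    ...   | true = decides-continue (advanceJ-tape (suc p) l v rs)
            (cong₂ (λ f z → endOfPass (advanceJ false false f z)) (<⇒inRange l v l<n) bad)
            (decides-continue (compare-tape p l v rs) (cong (λ z → if z then continue startJ else finish false) ok)
              (decides-⇔ (j-loop r (suc l) (trans (sym (+-suc l r)) eqn) longer)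
                (λ (same , pw , pf) → same , include-l pw , pf)
                (λ (same , pw , pf) → same , (λ q l<q q<n → pw q (≤-trans (n≤1+n l) l<q) q<n) , pf)))
      where
      l<n : l < n
      l<n = in-range l r eqn
      longer : AtLeast (suc l)
      longer = extend-AtLeast l l<n
        (All.map (λ e → trans e (<⇒inRange l v l<n)) (proj₂ (mismatch-false l (inRange l v) false rs bad)))
      include-l : PairsWith p (suc l) → PairsWith p l
      include-l pw q l≤q q<n with m≤n⇒m<n∨m≡n l≤q
      ... | inj₁ l<q  = pw q l<q q<n
      ... | inj₂ refl = ok

  i-loop : ∀ r k → k + r ≡ n → AtLeast k → ∀ l → Decides (iPasses n r) startI (tapeCells k l rows) (SameLength × PairsFrom k)
  i-loop zero k k+0≡n atleast l with mismatch k (inRange k v) false rs in bad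
  ... | true = decides-finish false (advanceI-tape k l v rs)
        (cong₂ (λ f z → endOfPass (advanceI false false f z)) (end-of-range k k+0≡n) bad)
        (λ ()) (λ (same , _) → ⊥-elim (mismatch⇒¬SameLength k bad same))
  ... | false = decides-finish true (advanceI-tape k l v rs)
        (cong₂ (λ f z → endOfPass (advanceI false false f z)) (end-of-range k k+0≡n) bad)
        (λ _ → AtLeast⇒SameLength (subst AtLeast k≡n atleast)
                 (subst (λ m → All (λ r → inRange m r ≡ false) rs) k≡n
                   (All.map (λ e → trans e (end-of-range k k+0≡n)) (proj₂ (mismatch-false k (inRange k v) false rs bad)))) ,
               λ p q k≤p p<n _ → ⊥-elim (<-irrefl refl (≤-trans p<n (subst (_≤ p) k≡n k≤p))))
        (λ _ → refl)
    where
    k≡n : k ≡ n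
    k≡n = trans (sym (+-identityʳ k)) k+0≡n
  i-loop (suc r) k eqn atleast l with mismatch k (inRange k v) false rs in bad
  ... | true = decides-finish false (advanceI-tape k l v rs)
        (cong₂ (λ f z → endOfPass (advanceI false false f z)) (<⇒inRange k v (in-range k r eqn)) bad)
        (λ ()) (λ (same , _) → ⊥-elim (mismatch⇒¬SameLength k bad same))
  ... | false = decides-continue (advanceI-tape k l v rs)
        (cong₂ (λ f z → endOfPass (advanceI false false f z)) (<⇒inRange k v k<n) bad)
        (decides-⇔ (j-loop k (i-loop r (suc k) (trans (sym (+-suc k r)) eqn) longer) n 0 refl AtLeast-zero)
          (λ (same , pw , pf) → same , include-k pw pf)
          (λ (same , pf) → same , (λ q _ q<n → pf k q ≤-refl k<n q<n) , (λ p q k<p → pf p q (≤-trans (n≤1+n k) k<p))))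
    where
    k<n : k < n
    k<n = in-range k r eqn
    longer : AtLeast (suc k)
    longer = extend-AtLeast k k<n
      (All.map (λ e → trans e (<⇒inRange k v k<n)) (proj₂ (mismatch-false k (inRange k v) false rs bad)))
    include-k : PairsWith k 0 → PairsFrom (suc k) → PairsFrom k
    include-k pw pf p q k≤p p<n q<n with m≤n⇒m<n∨m≡n k≤p
    ... | inj₁ k<p  = pf p q k<p p<n q<n
    ... | inj₂ refl = pw q z≤n q<n

decides-≤ : ∀ {k k′ s cs P} → k ≤ k′ → Decides k s cs P → Decides k′ s cs P
decides-≤ {k} {k′} {s} {cs} k≤k′ (decides b within sound complete) = decides b later sound complete
  where
  later : ∀ e → runPasses (k′ + e) s cs ≡ just b
  later e = trans (cong (λ t → runPasses t s cs) (trans (cong (_+ e) (sym (m+[n∸m]≡n k≤k′))) (+-assoc k (k′ ∸ k) e)))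
                  (within (k′ ∸ k + e))

double-mono : ∀ {a b} → a ≤ b → double a ≤ double b
double-mono z≤n       = z≤n
double-mono (s≤s a≤b) = s≤s (s≤s (double-mono a≤b))

iPasses-mono : ∀ {n n′ r r′} → n ≤ n′ → r ≤ r′ → iPasses n r ≤ iPasses n′ r′
iPasses-mono {r = zero}  {zero}   _    z≤n       = ≤-refl
iPasses-mono {r = zero}  {suc r′} _    z≤n       = s≤s z≤n
iPasses-mono {r = suc r} {suc r′} n≤n′ (s≤s r≤r′) = s≤s (+-mono-≤ (double-mono n≤n′) (s≤s (iPasses-mono n≤n′ r≤r′)))

iterateNext-several : ∀ m → iterateNext several m ≡ several
iterateNext-several zero    = refl
iterateNext-several (suc m) = iterateNext-several m

WellFormed : List InSym → Set
WellFormed w = Σ (List Bool) λ v → Σ (List Bool) λ r → Σ (List (List Bool)) λ rs → splitBlocks w ≡ (v ∷ r ∷ rs , [])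

Accepted : List InSym → Set
Accepted w = Σ (List Bool) λ v → Σ (List Bool) λ r → Σ (List (List Bool)) λ rs →
  splitBlocks w ≡ (v ∷ r ∷ rs , []) × Loop.SameLength v (r ∷ rs) × Loop.PairsFrom v (r ∷ rs) 0

parse-outcome : ∀ a w → (WellFormed w × endOfPass (parsedPhase a none true (splitBlocks w)) ≡ continue startI)
                      ⊎ (endOfPass (parsedPhase a none true (splitBlocks w)) ≡ finish false × ¬ WellFormed w)
parse-outcome a w with splitBlocks w
... | []               , t      = inj₂ (refl , λ { (_ , _ , _ , ()) })
... | _ ∷ []           , t      = inj₂ (refl , λ { (_ , _ , _ , ()) })
... | v ∷ r ∷ rs       , []     rewrite iterateNext-several (length rs) = inj₁ ((v , r , rs , refl) , refl)
... | v ∷ r ∷ rs       , _ ∷ _  rewrite iterateNext-several (length rs) = inj₂ (refl , λ { (_ , _ , _ , ()) })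

word-blocks : ∀ w {v r rs} → splitBlocks w ≡ (v ∷ r ∷ rs , []) → w ≡ concatMap encodeBlock (v ∷ r ∷ rs)
word-blocks w eq = trans (splitBlocks-sound w)
  (trans (cong joinBlocks eq) (++-identityʳ _))

length-first-block : ∀ v rest → length v ≤ length (concatMap encodeBlock (v ∷ rest))
length-first-block []      rest = z≤n
length-first-block (_ ∷ v) rest = s≤s (length-first-block v rest)

parse-then-loop : ∀ w → Decides (suc (iPasses (length w) (length w))) startParse (map inputCell w) (Accepted w)
parse-then-loop w with parse-outcome (null w ∧ true) w
... | inj₂ (end , ill-formed) =
  decides-finish false pass-eq end (λ ())
    (λ (v , r , rs , eq , _) → ⊥-elim (ill-formed (v , r , rs , eq)))
  where
  pass-eq : passCells startParse (map inputCell w) ≡ (parsedPhase (null w ∧ true) none true (splitBlocks w) , map inputCell w)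
  pass-eq = cong₂ _,_ (parse-phase true none true w) (parse-keeps-tape true none true w)
... | inj₁ ((v , r , rs , eq) , end) =
  decides-continue {K = iPasses (length w) (length w)} pass-eq end
    (decides-≤ (iPasses-mono short short)
      (subst (λ cs → Decides _ startI cs (Accepted w)) (sym tape)
        (decides-⇔ (Loop.i-loop v (r ∷ rs) (length v) 0 refl (Loop.AtLeast-zero v (r ∷ rs)) 0)
          (λ (same , pf) → v , r , rs , eq , same , pf)
          from-accepted)))
  where
  pass-eq : passCells startParse (map inputCell w) ≡ (parsedPhase (null w ∧ true) none true (splitBlocks w) , map inputCell w)
  pass-eq = cong₂ _,_ (parse-phase true none true w) (parse-keeps-tape true none true w)
  tape : map inputCell w ≡ tapeCells 0 0 (v ∷ r ∷ rs)
  tape = trans (cong (map inputCell) (word-blocks w eq)) (inputCells-encode (v ∷ r ∷ rs))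
  from-accepted : Accepted w → Loop.SameLength v (r ∷ rs) × Loop.PairsFrom v (r ∷ rs) 0
  from-accepted (_ , _ , _ , eq′ , same , pf) with trans (sym eq) eq′
  ... | refl = same , pf
  short : length v ≤ length w
  short = subst (λ u → length v ≤ length u) (sym (word-blocks w eq)) (length-first-block v (r ∷ rs))

-- Correctness and running time

PairSpec : Bool → Bool → Bool → Bool → Bool → Set
PairSpec a b sij si sj = (a ≡ true → b ≡ false → sij ≡ true) × (a ≡ true → si ≡ true) × (b ≡ false → sj ≡ true)

pairOK⇒spec : ∀ a b sij si sj → pairOK (just a) (just b) sij si sj ≡ true → PairSpec a b sij si sj
pairOK⇒spec a b sij si sj ok =
  (λ ai bf → not-∨-elim (a ∧ not b) sij ok-ij (cong₂ _∧_ ai (cong not bf))) ,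
  not-∨-elim a si ok-i ,
  (λ bf → not-∨-elim (not b) sj ok-j (cong not bf))
  where
  ok-ij : not (a ∧ not b) ∨ sij ≡ true
  ok-ij = ∧-conicalˡ (not (a ∧ not b) ∨ sij) ((not a ∨ si) ∧ (not (not b) ∨ sj)) ok
  ok-i-j : (not a ∨ si) ∧ (not (not b) ∨ sj) ≡ true
  ok-i-j = ∧-conicalʳ (not (a ∧ not b) ∨ sij) ((not a ∨ si) ∧ (not (not b) ∨ sj)) ok
  ok-i : not a ∨ si ≡ true
  ok-i = ∧-conicalˡ (not a ∨ si) (not (not b) ∨ sj) ok-i-j
  ok-j : not (not b) ∨ sj ≡ true
  ok-j = ∧-conicalʳ (not a ∨ si) (not (not b) ∨ sj) ok-i-j

spec⇒pairOK : ∀ a b sij si sj → PairSpec a b sij si sj → pairOK (just a) (just b) sij si sj ≡ true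
spec⇒pairOK a b sij si sj (h-ij , h-i , h-j) = cong₂ _∧_
  (not-∨-intro (a ∧ not b) sij (λ e → h-ij (∧-conicalˡ a (not b) e) (not-≡true (∧-conicalʳ a (not b) e))))
  (cong₂ _∧_ (not-∨-intro a si h-i) (not-∨-intro (not b) sj (λ e → h-j (not-≡true e))))

anyFrom⇒any : ∀ f x rows → anyFrom f x rows ≡ true → x ≡ true ⊎ Any (λ r → f r ≡ true) rows
anyFrom⇒any f x []       e = inj₁ e
anyFrom⇒any f x (r ∷ rs) e with anyFrom⇒any f (x ∨ f r) rs e
... | inj₂ found = inj₂ (there found)
... | inj₁ x∨fr with x | f r in fr
...   | true  | _    = inj₁ refl
...   | false | true = inj₂ (here fr)

anyFrom-true : ∀ f rows → anyFrom f true rows ≡ true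
anyFrom-true f []       = refl
anyFrom-true f (r ∷ rs) = anyFrom-true f rs

any⇒anyFrom : ∀ f x rows → Any (λ r → f r ≡ true) rows → anyFrom f x rows ≡ true
any⇒anyFrom f x (r ∷ rs) (here fr) rewrite fr | ∨-zeroʳ x = anyFrom-true f rs
any⇒anyFrom f x (r ∷ rs) (there found) = any⇒anyFrom f (x ∨ f r) rs found

lookupOr-toList : ∀ {n} (v : Vec Bool n) i → lookupOr nothing (toList v) (toℕ i) ≡ just (lookup v i)
lookupOr-toList (x ∷ v) zero    = refl
lookupOr-toList (x ∷ v) (suc i) = lookupOr-toList v i

module _ {n} (S : List (Vec Bool n)) where

  rows⇒any : ∀ f {P : Vec Bool n → Set} → (∀ s → f (toList s) ≡ true → P s) →
    anyFrom f false (map toList S) ≡ true → Any P S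
  rows⇒any f convert e with anyFrom⇒any f false (map toList S) e
  ... | inj₂ found = Any.map (λ {s} → convert s) (Any-map⁻ found)

  any⇒rows : ∀ f {P : Vec Bool n → Set} → (∀ s → P s → f (toList s) ≡ true) →
    Any P S → anyFrom f false (map toList S) ≡ true
  any⇒rows f convert found = any⇒anyFrom f false (map toList S) (Any-map⁺ (Any.map (λ {s} → convert s) found))

  module _ (v : Vec Bool n) (i j : Fin n) where

    private
      p q : ℕ
      p = toℕ i
      q = toℕ j

      trueAt-lookup : ∀ s → trueAt p (toList s) ≡ lookup s i
      trueAt-lookup s = cong isTrue (lookupOr-toList s i)

      falseAt-lookup : ∀ s → falseAt q (toList s) ≡ not (lookup s j)
      falseAt-lookup s = cong isFalse (lookupOr-toList s j)

      separatesAt-lookup : ∀ s → separatesAt p q (toList s) ≡ lookup s i ∧ not (lookup s j)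
      separatesAt-lookup s = cong₂ _∧_ (trueAt-lookup s) (falseAt-lookup s)

      pairCheck-lookup : pairCheck p q (toList v) (map toList S) ≡
        pairOK (just (lookup v i)) (just (lookup v j)) (anyFrom (separatesAt p q) false (map toList S))
          (anyFrom (trueAt p) false (map toList S)) (anyFrom (falseAt q) false (map toList S))
      pairCheck-lookup rewrite lookupOr-toList v i | lookupOr-toList v j = refl

    pairCheck⇒separatedAt : pairCheck p q (toList v) (map toList S) ≡ true → SeparatedAt S v i j
    pairCheck⇒separatedAt ok with pairOK⇒spec _ _ _ _ _ (trans (sym pairCheck-lookup) ok)
    ... | h-ij , h-i , h-j =
      (λ vi vj → rows⇒any (separatesAt p q)
        (λ s e → let e′ = trans (sym (separatesAt-lookup s)) e
                 in ∧-conicalˡ _ _ e′ , not-≡true (∧-conicalʳ _ _ e′)) (h-ij vi vj)) ,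
      (λ vi → rows⇒any (trueAt p) (λ s e → trans (sym (trueAt-lookup s)) e) (h-i vi)) ,
      (λ vj → rows⇒any (falseAt q) (λ s e → not-≡true (trans (sym (falseAt-lookup s)) e)) (h-j vj))

    separatedAt⇒pairCheck : SeparatedAt S v i j → pairCheck p q (toList v) (map toList S) ≡ true
    separatedAt⇒pairCheck (h-ij , h-i , h-j) = trans pairCheck-lookup (spec⇒pairOK _ _ _ _ _
      ((λ vi vj → any⇒rows (separatesAt p q)
          (λ s (si , sj) → trans (separatesAt-lookup s) (cong₂ _∧_ si (cong not sj))) (h-ij vi vj)) ,
       (λ vi → any⇒rows (trueAt p) (λ s si → trans (trueAt-lookup s) si) (h-i vi)) ,
       (λ vj → any⇒rows (falseAt q) (λ s sj → trans (falseAt-lookup s) (cong not sj)) (h-j vj))))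

toVec : (xs : List Bool) → ∀ {n} → length xs ≡ n → Vec Bool n
toVec []       refl = []
toVec (x ∷ xs) refl = x ∷ toVec xs refl

toList-toVec : ∀ xs {n} (e : length xs ≡ n) → toList (toVec xs e) ≡ xs
toList-toVec []       refl = refl
toList-toVec (x ∷ xs) refl = cong (x ∷_) (toList-toVec xs refl)

toVecs : ∀ {n} (rows : List (List Bool)) → All (λ r → length r ≡ n) rows → List (Vec Bool n)
toVecs []         []           = []
toVecs (r ∷ rows) (e ∷ same)   = toVec r e ∷ toVecs rows same

toList-toVecs : ∀ {n} rows (same : All (λ r → length r ≡ n) rows) → map toList (toVecs rows same) ≡ rows
toList-toVecs []         []         = refl
toList-toVecs (r ∷ rows) (e ∷ same) = cong₂ _∷_ (toList-toVec r e) (toList-toVecs rows same)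

encode-blocks : ∀ n S (v : Vec Bool n) → encode n S v ≡ concatMap encodeBlock (toList v ∷ map toList S)
encode-blocks n S v = cong (encVec v ++_) (cong concat (map-∘ S))

accepted⇒closure : ∀ w → Accepted w → ClosureM₂ w
accepted⇒closure w (v , r , rs , eq , same@(_ ∷ _) , pairs) =
  length v , S , V , word , separated⇒closure (here tt , λ i j → pairCheck⇒separatedAt S V i j (pair i j))
  where
  S : List (Vec Bool (length v))
  S = toVecs (r ∷ rs) same
  V : Vec Bool (length v)
  V = toVec v {length v} refl
  blocks : toList V ∷ map toList S ≡ v ∷ r ∷ rs
  blocks = cong₂ _∷_ (toList-toVec v refl) (toList-toVecs (r ∷ rs) same)
  word : w ≡ encode (length v) S V
  word = trans (word-blocks w eq) (sym (trans (encode-blocks (length v) S V) (cong (concatMap encodeBlock) blocks)))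
  pair : ∀ i j → pairCheck (toℕ i) (toℕ j) (toList V) (map toList S) ≡ true
  pair i j = subst₂ (λ v′ rows → pairCheck (toℕ i) (toℕ j) v′ rows ≡ true)
    (sym (toList-toVec v refl)) (sym (toList-toVecs (r ∷ rs) same)) (pairs (toℕ i) (toℕ j) z≤n (toℕ<n i) (toℕ<n j))

closure⇒accepted : ∀ w → ClosureM₂ w → Accepted w
closure⇒accepted w (n , S , V , word , cl) with closure⇒separated cl
... | nonempty , separation with S | nonempty
... | s ∷ S′ | _ = toList V , toList s , map toList S′ , blocks , same , pairs
  where
  blocks : splitBlocks w ≡ (toList V ∷ toList s ∷ map toList S′ , [])
  blocks = trans (cong splitBlocks (trans word (encode-blocks n (s ∷ S′) V))) (splitBlocks-encode _)
  length-n : ∀ (x : Vec Bool n) → length (toList x) ≡ length (toList V)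
  length-n x = trans (length-toList x) (sym (length-toList V))
  same : All (λ r → length r ≡ length (toList V)) (toList s ∷ map toList S′)
  same = length-n s ∷ All-map⁺ (All.universal length-n S′)
  pairs : Loop.PairsFrom (toList V) (toList s ∷ map toList S′) 0
  pairs p q _ p<n q<n = subst₂ (λ p′ q′ → pairCheck p′ q′ (toList V) (toList s ∷ map toList S′) ≡ true)
    (toℕ-fromℕ< p<n′) (toℕ-fromℕ< q<n′)
    (separatedAt⇒pairCheck (s ∷ S′) V (fromℕ< p<n′) (fromℕ< q<n′) (separation _ _))
    where
    p<n′ : p < n
    p<n′ = subst (p <_) (length-toList V) p<n
    q<n′ : q < n
    q<n′ = subst (q <_) (length-toList V) q<n

iPasses-bound : ∀ n r → iPasses n r ≤ suc r * double (suc n)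
iPasses-bound n zero    = s≤s z≤n
iPasses-bound n (suc r) = subst (_≤ suc (suc r) * double (suc n)) (sym (cong suc (+-suc (double n) (iPasses n r))))
                            (+-monoʳ-≤ (double (suc n)) (iPasses-bound n r))

double≡+ : ∀ m → double m ≡ m + m
double≡+ zero    = refl
double≡+ (suc m) = cong suc (trans (cong suc (double≡+ m)) (sym (+-suc m m)))

passes-bound : ∀ n → suc (iPasses n n) ≤ 3 * (suc n * suc n)
passes-bound n = begin
  suc (iPasses n n)      ≤⟨ s≤s (iPasses-bound n n) ⟩
  suc (a * double a)     ≡⟨ cong (λ d → suc (a * d)) (double≡+ a) ⟩
  1 + a * (a + a)        ≤⟨ +-monoˡ-≤ (a * (a + a)) (*-mono-≤ {1} {a} {1} {a} (s≤s z≤n) (s≤s z≤n)) ⟩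
  a * a + a * (a + a)    ≡⟨ solve 1 (λ a → a :* a :+ a :* (a :+ a) := con 3 :* (a :* a)) refl a ⟩
  3 * (a * a)            ∎
  where
  a : ℕ
  a = suc n
  open ≤-Reasoning

passCost-bound : ∀ n → passCost n ≤ 3 * suc n
passCost-bound n = subst (passCost n ≤_) (solve 1 (λ n → (n :+ (con 1 :+ n)) :+ (con 2 :+ n) := con 3 :* (con 1 :+ n)) refl n)
                     (m≤m+n (passCost n) (suc (suc n)))

running-time : ∀ n → suc (iPasses n n) * passCost n ≤ 9 * suc n ^ 3
running-time n = ≤-trans (*-mono-≤ (passes-bound n) (passCost-bound n))
  (≤-reflexive (solve 1 (λ a → (con 3 :* (a :* a)) :* (con 3 :* a) := con 9 :* (a :* (a :* (a :* con 1))))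
                       refl (suc n)))

proposition9 : InP ClosureM₂
proposition9 = machine , 9 , 3 , λ w → decide w (parse-then-loop w)
  where
  decide : ∀ w → Decides (suc (iPasses (length w) (length w))) startParse (map inputCell w) (Accepted w) →
    Σ Bool λ b → (run machine (9 * suc (length w) ^ 3) (initial machine w) ≡ just b)
               × (b ≡ true → ClosureM₂ w) × (ClosureM₂ w → b ≡ true)
  decide w (decides b within sound complete) =
    b ,
    run-≤ (initial machine w) (running-time (length w))
      (initial-run _ w (subst (λ k → runPasses k startParse (map inputCell w) ≡ just b)
                              (+-identityʳ _) (within 0))) ,
    (λ e → accepted⇒closure w (sound e)) ,
    (λ c → complete (closure⇒accepted w c))
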